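{- Up to isomorphism, there are exactly six biased graphs with underlying graph $2C_3$ that have no balancing vertex.
   Context: $2C_3$ is the graph obtained from a triangle by replacing each edge with two parallel edges. A biased graph is a graph with a set of cycles (called balanced) such that no theta subgraph (union of three internally disjoint paths between two vertices) contains exactly two balanced cycles. A balancing vertex is a vertex lying on every unbalanced cycle. Isomorphisms of biased graphs are graph isomorphisms carrying balanced cycles to balanced cycles; "unlabeled" in the paper means up to such isomorphism. -}

module Defs where

open import Data.Nat using (ℕ; zero; suc; _+_)
open import Data.Bool using (Bool; true; false; if_then_else_; T)
open import Data.Fin using (Fin; zero; suc; _≟_)
open import Data.Fin.Subset using (Subset; _∈_; _⊆_; _∩_; _∪_; _─_; ⊥; Nonempty)
open import Data.Fin.Subset.Properties using (_∈?_)
open import Data.Fin.Permutation using (Permutation′; _⟨$⟩ʳ_; _⟨$⟩ˡ_)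
open import Data.List using (List; map; allFin)
open import Data.Nat.ListAction using (sum)
open import Data.Vec using (lookup; tabulate)
open import Data.Product using (Σ; ∃; _×_; _,_)
open import Data.Sum using (_⊎_)
open import Relation.Nullary using (¬_; Dec; yes; no)
open import Relation.Binary.PropositionalEquality using (_≡_; _≢_)

record Graph : Set where
  field
    nV nE : ℕ
    end₁ end₂ : Fin nE → Fin nV
open Graph public

-- The graph 2C₃: vertices 0,1,2; edges 0,1 join 0–1, edges 2,3 join 1–2,
-- edges 4,5 join 2–0.
twoC3 : Graph
twoC3 = record { nV = 3 ; nE = 6 ; end₁ = e₁ ; end₂ = e₂ }
  where
  e₁ e₂ : Fin 6 → Fin 3
  e₁ zero = zero
  e₁ (suc zero) = zero
  e₁ (suc (suc zero)) = suc zero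
  e₁ (suc (suc (suc zero))) = suc zero
  e₁ (suc (suc (suc (suc zero)))) = suc (suc zero)
  e₁ (suc (suc (suc (suc (suc zero))))) = suc (suc zero)
  e₂ zero = suc zero
  e₂ (suc zero) = suc zero
  e₂ (suc (suc zero)) = suc (suc zero)
  e₂ (suc (suc (suc zero))) = suc (suc zero)
  e₂ (suc (suc (suc (suc zero)))) = zero
  e₂ (suc (suc (suc (suc (suc zero))))) = zero

module _ (G : Graph) where

  EdgeSet : Set
  EdgeSet = Subset (nE G)

  δ : Fin (nV G) → Fin (nV G) → ℕ
  δ a b with a ≟ b
  ... | yes _ = 1
  ... | no _ = 0

  deg : EdgeSet → Fin (nV G) → ℕ
  deg S v = sum (map (λ e → contrib e (e ∈? S)) (allFin (nE G)))
    where
    contrib : (e : Fin (nE G)) → Dec (e ∈ S) → ℕ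
    contrib e (yes _) = δ (end₁ G e) v + δ (end₂ G e) v
    contrib e (no _) = 0

  Touches : EdgeSet → Fin (nV G) → Set
  Touches S v = ∃ λ e → e ∈ S × (end₁ G e ≡ v ⊎ end₂ G e ≡ v)

  Connected : EdgeSet → Set
  Connected S = ∀ A → A ⊆ S → Nonempty A → Nonempty (S ─ A) →
                ∃ λ v → Touches A v × Touches (S ─ A) v

  Cycle : EdgeSet → Set
  Cycle C = Nonempty C × (∀ v → deg C v ≡ 0 ⊎ deg C v ≡ 2) × Connected C

  Path : Fin (nV G) → Fin (nV G) → EdgeSet → Set
  Path u v P = u ≢ v × deg P u ≡ 1 × deg P v ≡ 1
             × (∀ w → w ≢ u → w ≢ v → deg P w ≡ 0 ⊎ deg P w ≡ 2)
             × Connected P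

  InternallyDisjoint : Fin (nV G) → Fin (nV G) → EdgeSet → EdgeSet → Set
  InternallyDisjoint u v P Q =
    P ∩ Q ≡ ⊥ × (∀ w → w ≢ u → w ≢ v → Touches P w → Touches Q w → Data.Empty.⊥)
    where import Data.Empty

  Theta : EdgeSet → Set
  Theta Θ = Σ (Fin (nV G)) λ u → Σ (Fin (nV G)) λ v →
            Σ EdgeSet λ P₁ → Σ EdgeSet λ P₂ → Σ EdgeSet λ P₃ →
            Path u v P₁ × Path u v P₂ × Path u v P₃
            × InternallyDisjoint u v P₁ P₂ × InternallyDisjoint u v P₁ P₃
            × InternallyDisjoint u v P₂ P₃
            × Θ ≡ P₁ ∪ P₂ ∪ P₃

  ExactlyTwoBalanced : (EdgeSet → Bool) → EdgeSet → Set
  ExactlyTwoBalanced bal Θ = Σ EdgeSet λ C₁ → Σ EdgeSet λ C₂ →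
    C₁ ≢ C₂ × Cycle C₁ × Cycle C₂ × C₁ ⊆ Θ × C₂ ⊆ Θ
    × bal C₁ ≡ true × bal C₂ ≡ true
    × (∀ C → Cycle C → C ⊆ Θ → bal C ≡ true → C ≡ C₁ ⊎ C ≡ C₂)

  record BiasedGraph : Set where
    field
      balanced : EdgeSet → Bool
      balanced⇒cycle : ∀ C → balanced C ≡ true → Cycle C
      thetaProperty : ∀ Θ → Theta Θ → ¬ ExactlyTwoBalanced balanced Θ
  open BiasedGraph public

  BalancingVertex : BiasedGraph → Fin (nV G) → Set
  BalancingVertex Ω v = ∀ C → Cycle C → balanced Ω C ≡ false → Touches C v

  NoBalancingVertex : BiasedGraph → Set
  NoBalancingVertex Ω = ∀ v → ¬ BalancingVertex Ω v

  image : Permutation′ (nE G) → EdgeSet → EdgeSet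
  image τ S = tabulate (λ f → lookup S (τ ⟨$⟩ˡ f))

  record Iso (Ω₁ Ω₂ : BiasedGraph) : Set where
    field
      σ : Permutation′ (nV G)
      τ : Permutation′ (nE G)
      incidence : ∀ e →
        (end₁ G (τ ⟨$⟩ʳ e) ≡ σ ⟨$⟩ʳ end₁ G e × end₂ G (τ ⟨$⟩ʳ e) ≡ σ ⟨$⟩ʳ end₂ G e)
        ⊎ (end₁ G (τ ⟨$⟩ʳ e) ≡ σ ⟨$⟩ʳ end₂ G e × end₂ G (τ ⟨$⟩ʳ e) ≡ σ ⟨$⟩ʳ end₁ G e)
      preservesBalance : ∀ C → Cycle C → balanced Ω₂ (image τ C) ≡ balanced Ω₁ C

-- The cycles of 2C₃ are the three digons and the eight triangles (one edge from each parallel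
-- pair), and its thetas are the unions of a digon with a triangle; such a theta contains exactly
-- three cycles: the digon and the two triangles that agree off the digon's parallel pair.  Hence
-- a biased graph on 2C₃ is the same thing as a set β of these eleven cycles such that no theta
-- contains exactly two members of β, and a vertex is balancing iff it meets every cycle outside β.
-- Every automorphism of 2C₃ is a vertex permutation together with a choice, for each parallel
-- pair, of whether to swap it; these 48 automorphisms act on the 2¹¹ candidate sets β.  A finite
-- computation shows that each β either violates the theta property, has a balancing vertex, or is
-- carried onto one of six explicit representatives, and that no automorphism relates two distinct
-- representatives.
module Submission where

open import Defs
open import Data.Bool using (Bool; true; false; if_then_else_)
import Data.Bool as Bool
open import Data.Bool.Properties using (¬-not)
open import Data.Empty using (⊥-elim)
open import Data.Fin using (Fin; _≟_; _↑ˡ_; _↑ʳ_; splitAt; remQuot; combine; opposite)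
open import Data.Fin.Patterns using (0F; 1F; 2F; 3F; 4F; 5F)
open import Data.Fin.Permutation
  using (Permutation′; permutation; _⟨$⟩ʳ_; _⟨$⟩ˡ_; inverseˡ; inverseʳ; id; transpose; _∘ₚ_)
open import Data.Fin.Properties using (any?; all?; opposite-involutive)
open import Data.Fin.Subset using (Subset; _⊆_; _∩_; _∪_; _─_; ⁅_⁆; ⊥)
open import Data.Fin.Subset.Properties using (_∈?_; _⊆?_; nonempty?; anySubset?)
import Data.Nat as ℕ
open import Data.Product using (Σ; ∃; _×_; _,_; proj₁; proj₂; Σ-syntax)
open import Data.Sum using (_⊎_; inj₁; inj₂)
import Data.Sum as Sum
open import Data.Vec using (lookup; tabulate)
open import Data.Vec.Functional using (Vector; []; _∷_; updateAt)
import Data.Vec.Properties as Vec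
open import Function using (_∘_; const; _⇔_; mk⇔; Equivalence)
open import Function.Bundles using (Injection)
open import Function.Properties.Inverse using (↔⇒↣)
open import Relation.Binary using (DecidableEquality)
open import Relation.Binary.PropositionalEquality
  using (_≡_; _≢_; _≗_; refl; sym; trans; cong; cong₂; subst; module ≡-Reasoning)
open import Relation.Nullary using (Dec; yes; no; does; ¬_; ¬?)
open import Relation.Nullary.Decidable using (map′; _×-dec_; _⊎-dec_; _→-dec_; decidable-stable; from-yes)
open import Relation.Unary using (Decidable)

∀-subset? : ∀ {n p} {P : Subset n → Set p} → Decidable P → Dec (∀ S → P S)
∀-subset? P? = map′ (λ ∄¬P S → decidable-stable (P? S) (λ ¬PS → ∄¬P (S , ¬PS)))
                    (λ ∀P (S , ¬PS) → ¬PS (∀P S))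
                    (¬? (anySubset? (¬? ∘ P?)))

infix 4 _≟ₛ_
_≟ₛ_ : ∀ {n} → DecidableEquality (Subset n)
_≟ₛ_ = Vec.≡-dec Bool._≟_

module _ (G : Graph) where

  touches? : ∀ S v → Dec (Touches G S v)
  touches? S v = any? λ e → e ∈? S ×-dec (end₁ G e ≟ v ⊎-dec end₂ G e ≟ v)

  connected? : ∀ S → Dec (Connected G S)
  connected? S = ∀-subset? λ A → A ⊆? S →-dec nonempty? A →-dec nonempty? (S ─ A) →-dec
                   any? λ v → touches? A v ×-dec touches? (S ─ A) v

  evenDegree? : ∀ S v → Dec (deg G S v ≡ 0 ⊎ deg G S v ≡ 2)
  evenDegree? S v = deg G S v ℕ.≟ 0 ⊎-dec deg G S v ℕ.≟ 2

  cycle? : ∀ C → Dec (Cycle G C)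
  cycle? C = nonempty? C ×-dec all? (evenDegree? C) ×-dec connected? C

  path? : ∀ u v P → Dec (Path G u v P)
  path? u v P = ¬? (u ≟ v) ×-dec deg G P u ℕ.≟ 1 ×-dec deg G P v ℕ.≟ 1 ×-dec
                all? (λ w → ¬? (w ≟ u) →-dec ¬? (w ≟ v) →-dec evenDegree? P w) ×-dec connected? P

  internallyDisjoint? : ∀ u v P Q → Dec (InternallyDisjoint G u v P Q)
  internallyDisjoint? u v P Q = (P ∩ Q) ≟ₛ ⊥ ×-dec
    all? λ w → ¬? (w ≟ u) →-dec ¬? (w ≟ v) →-dec touches? P w →-dec touches? Q w →-dec no λ ()

ExactlyTwo : ∀ {n} → (Fin n → Bool) → Set
ExactlyTwo b = Σ[ i ∈ _ ] Σ[ j ∈ _ ] i ≢ j × b i ≡ true × b j ≡ true × (∀ k → b k ≡ true → k ≡ i ⊎ k ≡ j)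

exactlyTwo? : ∀ {n} (b : Fin n → Bool) → Dec (ExactlyTwo b)
exactlyTwo? b = any? λ i → any? λ j → ¬? (i ≟ j) ×-dec b i Bool.≟ true ×-dec b j Bool.≟ true ×-dec
                  all? λ k → b k Bool.≟ true →-dec (k ≟ i ⊎-dec k ≟ j)

ExactlyTwo-cong : ∀ {n} {b b′ : Fin n → Bool} → b ≗ b′ → ExactlyTwo b → ExactlyTwo b′
ExactlyTwo-cong b≗b′ (i , j , i≢j , bi , bj , only) =
  i , j , i≢j , trans (sym (b≗b′ i)) bi , trans (sym (b≗b′ j)) bj , λ k b′k → only k (trans (b≗b′ k) b′k)

module _ (G : Graph) where

  record EnumeratesCycles {n} (Θ : EdgeSet G) (c : Fin n → EdgeSet G) : Set where
    field
      isCycle : ∀ i → Cycle G (c i)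
      ⊆Θ : ∀ i → c i ⊆ Θ
      injective : ∀ i j → c i ≡ c j → i ≡ j
      complete : ∀ C → Cycle G C → C ⊆ Θ → ∃ λ i → C ≡ c i

  exactlyTwoBalanced⇔exactlyTwo : ∀ {n Θ} {c : Fin n → EdgeSet G} → EnumeratesCycles Θ c →
                                  ∀ bal → ExactlyTwoBalanced G bal Θ ⇔ ExactlyTwo (bal ∘ c)
  exactlyTwoBalanced⇔exactlyTwo {Θ = Θ} {c} enum bal = mk⇔ to from
    where
    open EnumeratesCycles enum

    to : ExactlyTwoBalanced G bal Θ → ExactlyTwo (bal ∘ c)
    to (C₁ , C₂ , C₁≢C₂ , cyc₁ , cyc₂ , C₁⊆Θ , C₂⊆Θ , bal₁ , bal₂ , only)
      with complete C₁ cyc₁ C₁⊆Θ | complete C₂ cyc₂ C₂⊆Θ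
    ... | i , refl | j , refl = i , j , (C₁≢C₂ ∘ cong c) , bal₁ , bal₂ ,
          λ k balk → Sum.map (injective k i) (injective k j) (only (c k) (isCycle k) (⊆Θ k) balk)

    from : ExactlyTwo (bal ∘ c) → ExactlyTwoBalanced G bal Θ
    from (i , j , i≢j , bal₁ , bal₂ , only) =
      c i , c j , (i≢j ∘ injective i j) , isCycle i , isCycle j , ⊆Θ i , ⊆Θ j , bal₁ , bal₂ , onlyTwo
      where
      onlyTwo : ∀ C → Cycle G C → C ⊆ Θ → bal C ≡ true → C ≡ c i ⊎ C ≡ c j
      onlyTwo C cycC C⊆Θ balC with complete C cycC C⊆Θ
      ... | k , refl = Sum.map (cong c) (cong c) (only k balC)

-- edge w i is the i-th of the two parallel edges not incident with the vertex w.
edge : Fin 3 → Fin 2 → Fin 6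
edge 0F 0F = 2F
edge 0F 1F = 3F
edge 1F 0F = 4F
edge 1F 1F = 5F
edge 2F 0F = 0F
edge 2F 1F = 1F

oppositeVertex : Fin 6 → Fin 3
oppositeVertex 0F = 2F
oppositeVertex 1F = 2F
oppositeVertex 2F = 0F
oppositeVertex 3F = 0F
oppositeVertex 4F = 1F
oppositeVertex 5F = 1F

parallelIndex : Fin 6 → Fin 2
parallelIndex 0F = 0F
parallelIndex 1F = 1F
parallelIndex 2F = 0F
parallelIndex 3F = 1F
parallelIndex 4F = 0F
parallelIndex 5F = 1F

-- Facts checked by evaluating a decision procedure are opaque, so that their proofs are never
-- unfolded (and the search re-run) when they are used.
opaque
  edge-η : ∀ e → edge (oppositeVertex e) (parallelIndex e) ≡ e
  edge-η = from-yes (all? λ e → edge (oppositeVertex e) (parallelIndex e) ≟ e)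

  oppositeVertex-edge : ∀ w i → oppositeVertex (edge w i) ≡ w
  oppositeVertex-edge = from-yes (all? λ w → all? λ i → oppositeVertex (edge w i) ≟ w)

  parallelIndex-edge : ∀ w i → parallelIndex (edge w i) ≡ i
  parallelIndex-edge = from-yes (all? λ w → all? λ i → parallelIndex (edge w i) ≟ i)

  end₁≢oppositeVertex : ∀ e → end₁ twoC3 e ≢ oppositeVertex e
  end₁≢oppositeVertex = from-yes (all? λ e → ¬? (end₁ twoC3 e ≟ oppositeVertex e))

  end₂≢oppositeVertex : ∀ e → end₂ twoC3 e ≢ oppositeVertex e
  end₂≢oppositeVertex = from-yes (all? λ e → ¬? (end₂ twoC3 e ≟ oppositeVertex e))

  avoidsEnds⇒oppositeVertex : ∀ e v → v ≢ end₁ twoC3 e → v ≢ end₂ twoC3 e → v ≡ oppositeVertex e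
  avoidsEnds⇒oppositeVertex = from-yes (all? λ e → all? λ v →
    ¬? (v ≟ end₁ twoC3 e) →-dec ¬? (v ≟ end₂ twoC3 e) →-dec v ≟ oppositeVertex e)

digon : Fin 3 → EdgeSet twoC3
digon w = ⁅ edge w 0F ⁆ ∪ ⁅ edge w 1F ⁆

triangle : Vector (Fin 2) 3 → EdgeSet twoC3
triangle x = ⁅ edge 0F (x 0F) ⁆ ∪ ⁅ edge 1F (x 1F) ⁆ ∪ ⁅ edge 2F (x 2F) ⁆

coordinates : Fin 8 → Vector (Fin 2) 3
coordinates t with remQuot {2} 4 t
... | a , bc with remQuot {2} 2 bc
...   | b , c = a ∷ b ∷ c ∷ []

-- Cycle w < 3 is digon w; cycle 3 + 4a + 2b + c is the triangle with coordinates a b c.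
cycle : Fin 11 → EdgeSet twoC3
cycle k with splitAt 3 k
... | inj₁ w = digon w
... | inj₂ t = triangle (coordinates t)

digonIx : Fin 3 → Fin 11
digonIx w = w ↑ˡ 8

triangleIx : Vector (Fin 2) 3 → Fin 11
triangleIx x = 3 ↑ʳ combine (x 0F) (combine (x 1F) (x 2F))

opaque
  cycle-isCycle : ∀ k → Cycle twoC3 (cycle k)
  cycle-isCycle = from-yes (all? λ k → cycle? twoC3 (cycle k))

  cycle-injective : ∀ k l → cycle k ≡ cycle l → k ≡ l
  cycle-injective = from-yes (all? λ k → all? λ l → cycle k ≟ₛ cycle l →-dec k ≟ l)

  cycle-surjective : ∀ C → Cycle twoC3 C → ∃ λ k → C ≡ cycle k
  cycle-surjective = from-yes (∀-subset? λ C → cycle? twoC3 C →-dec any? λ k → C ≟ₛ cycle k)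

thetaEdges : Fin 3 → Fin 8 → EdgeSet twoC3
thetaEdges w t = digon w ∪ triangle (coordinates t)

thetaCycle : Fin 3 → Fin 8 → Fin 3 → Fin 11
thetaCycle w t 0F = digonIx w
thetaCycle w t 1F = triangleIx (updateAt (coordinates t) w (const 0F))
thetaCycle w t 2F = triangleIx (updateAt (coordinates t) w (const 1F))

thetaEdges-isTheta : ∀ w t → Theta twoC3 (thetaEdges w t)
thetaEdges-isTheta w t = u w , v w , P₁ w , P₂ w , P₃ w t , from-yes (all? λ w → all? λ t → isTheta? w t) w t
  where
  u v : Fin 3 → Fin 3
  u w = end₁ twoC3 (edge w 0F)
  v w = end₂ twoC3 (edge w 0F)
  P₁ P₂ : Fin 3 → EdgeSet twoC3
  P₁ w = ⁅ edge w 0F ⁆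
  P₂ w = ⁅ edge w 1F ⁆
  P₃ : Fin 3 → Fin 8 → EdgeSet twoC3
  P₃ w t = triangle (coordinates t) ─ digon w
  isTheta? : ∀ w t →
    Dec (Path twoC3 (u w) (v w) (P₁ w) × Path twoC3 (u w) (v w) (P₂ w) × Path twoC3 (u w) (v w) (P₃ w t)
         × InternallyDisjoint twoC3 (u w) (v w) (P₁ w) (P₂ w) × InternallyDisjoint twoC3 (u w) (v w) (P₁ w) (P₃ w t)
         × InternallyDisjoint twoC3 (u w) (v w) (P₂ w) (P₃ w t) × thetaEdges w t ≡ P₁ w ∪ P₂ w ∪ P₃ w t)
  isTheta? w t =
    path? twoC3 (u w) (v w) (P₁ w) ×-dec path? twoC3 (u w) (v w) (P₂ w) ×-dec path? twoC3 (u w) (v w) (P₃ w t)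
    ×-dec internallyDisjoint? twoC3 (u w) (v w) (P₁ w) (P₂ w) ×-dec internallyDisjoint? twoC3 (u w) (v w) (P₁ w) (P₃ w t)
    ×-dec internallyDisjoint? twoC3 (u w) (v w) (P₂ w) (P₃ w t) ×-dec thetaEdges w t ≟ₛ P₁ w ∪ P₂ w ∪ P₃ w t

opaque
  threePaths⇒thetaEdges :
    ∀ u v P₁ → Path twoC3 u v P₁ → ∀ P₂ → Path twoC3 u v P₂ → ∀ P₃ → Path twoC3 u v P₃ →
    InternallyDisjoint twoC3 u v P₁ P₂ → InternallyDisjoint twoC3 u v P₁ P₃ → InternallyDisjoint twoC3 u v P₂ P₃ →
    ∃ λ w → ∃ λ t → P₁ ∪ P₂ ∪ P₃ ≡ thetaEdges w t
  threePaths⇒thetaEdges = from-yes (all? λ u → all? λ v → ∀-subset? λ P₁ → path? twoC3 u v P₁ →-dec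
    ∀-subset? λ P₂ → path? twoC3 u v P₂ →-dec ∀-subset? λ P₃ → path? twoC3 u v P₃ →-dec
    internallyDisjoint? twoC3 u v P₁ P₂ →-dec internallyDisjoint? twoC3 u v P₁ P₃ →-dec
    internallyDisjoint? twoC3 u v P₂ P₃ →-dec any? λ w → any? λ t → P₁ ∪ P₂ ∪ P₃ ≟ₛ thetaEdges w t)

  thetaCycle-⊆ : ∀ w t i → cycle (thetaCycle w t i) ⊆ thetaEdges w t
  thetaCycle-⊆ = from-yes (all? λ w → all? λ t → all? λ i → cycle (thetaCycle w t i) ⊆? thetaEdges w t)

  thetaCycle-injective : ∀ w t i j → thetaCycle w t i ≡ thetaCycle w t j → i ≡ j
  thetaCycle-injective = from-yes (all? λ w → all? λ t → all? λ i → all? λ j →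
    thetaCycle w t i ≟ thetaCycle w t j →-dec i ≟ j)

  ⊆thetaEdges⇒thetaCycle : ∀ w t k → cycle k ⊆ thetaEdges w t → ∃ λ i → k ≡ thetaCycle w t i
  ⊆thetaEdges⇒thetaCycle = from-yes (all? λ w → all? λ t → all? λ k →
    cycle k ⊆? thetaEdges w t →-dec any? λ i → k ≟ thetaCycle w t i)

theta⇒thetaEdges : ∀ Θ → Theta twoC3 Θ → ∃ λ w → ∃ λ t → Θ ≡ thetaEdges w t
theta⇒thetaEdges Θ (u , v , P₁ , P₂ , P₃ , π₁ , π₂ , π₃ , d₁₂ , d₁₃ , d₂₃ , refl) =
  threePaths⇒thetaEdges u v P₁ π₁ P₂ π₂ P₃ π₃ d₁₂ d₁₃ d₂₃

thetaEdges-enumeratesCycles : ∀ w t → EnumeratesCycles twoC3 (thetaEdges w t) (cycle ∘ thetaCycle w t)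
thetaEdges-enumeratesCycles w t = record
  { isCycle = cycle-isCycle ∘ thetaCycle w t
  ; ⊆Θ = thetaCycle-⊆ w t
  ; injective = λ i j → thetaCycle-injective w t i j ∘ cycle-injective (thetaCycle w t i) (thetaCycle w t j)
  ; complete = complete
  }
  where
  complete : ∀ C → Cycle twoC3 C → C ⊆ thetaEdges w t → ∃ λ i → C ≡ cycle (thetaCycle w t i)
  complete C cycC C⊆Θ =
    let k , C≡k = cycle-surjective C cycC
        i , k≡i = ⊆thetaEdges⇒thetaCycle w t k (subst (_⊆ thetaEdges w t) C≡k C⊆Θ)
    in i , trans C≡k (cong cycle k≡i)

Bias : Set
Bias = Subset 11

IsBiasOf : Bias → (EdgeSet twoC3 → Bool) → Set
IsBiasOf β bal = ∀ k → bal (cycle k) ≡ lookup β k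

balancedIndex? : ∀ β C → Dec (∃ λ k → lookup β k ≡ true × C ≡ cycle k)
balancedIndex? β C = any? λ k → lookup β k Bool.≟ true ×-dec C ≟ₛ cycle k

balancedBy : Bias → EdgeSet twoC3 → Bool
balancedBy β C = does (balancedIndex? β C)

balancedBy-isBias : ∀ β → IsBiasOf β (balancedBy β)
balancedBy-isBias β k = decided (balancedIndex? β (cycle k))
  where
  decided : (d : Dec (∃ λ l → lookup β l ≡ true × cycle k ≡ cycle l)) → does d ≡ lookup β k
  decided (yes (l , βl , k~l)) = sym (trans (cong (lookup β) (cycle-injective k l k~l)) βl)
  decided (no ∄l) = sym (¬-not λ βk → ∄l (k , βk , refl))

balancedBy⇒cycle : ∀ β C → balancedBy β C ≡ true → Cycle twoC3 C
balancedBy⇒cycle β C = decided (balancedIndex? β C)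
  where
  decided : (d : Dec (∃ λ k → lookup β k ≡ true × C ≡ cycle k)) → does d ≡ true → Cycle twoC3 C
  decided (yes (k , _ , C≡k)) _ = subst (Cycle twoC3) (sym C≡k) (cycle-isCycle k)

ThetaViolation : Bias → Set
ThetaViolation β = ∃ λ w → ∃ λ t → ExactlyTwo (lookup β ∘ thetaCycle w t)

thetaViolation? : ∀ β → Dec (ThetaViolation β)
thetaViolation? β = any? λ w → any? λ t → exactlyTwo? (lookup β ∘ thetaCycle w t)

exactlyTwoBalanced⇔ : ∀ β bal → IsBiasOf β bal → ∀ w t →
                      ExactlyTwoBalanced twoC3 bal (thetaEdges w t) ⇔ ExactlyTwo (lookup β ∘ thetaCycle w t)
exactlyTwoBalanced⇔ β bal isBias w t = mk⇔ (ExactlyTwo-cong (isBias ∘ thetaCycle w t) ∘ to)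
                                           (from ∘ ExactlyTwo-cong (sym ∘ isBias ∘ thetaCycle w t))
  where open Equivalence (exactlyTwoBalanced⇔exactlyTwo twoC3 (thetaEdges-enumeratesCycles w t) bal)

BalancingVertexOf : Bias → Fin 3 → Set
BalancingVertexOf β v = ∀ k → lookup β k ≡ false → Touches twoC3 (cycle k) v

balancingVertexOf? : ∀ β v → Dec (BalancingVertexOf β v)
balancingVertexOf? β v = all? λ k → lookup β k Bool.≟ false →-dec touches? twoC3 (cycle k) v

balancingVertex⇔ : ∀ Γ β → IsBiasOf β (balanced Γ) → ∀ v → BalancingVertex twoC3 Γ v ⇔ BalancingVertexOf β v
balancingVertex⇔ Γ β isBias v = mk⇔ to from
  where
  to : BalancingVertex twoC3 Γ v → BalancingVertexOf β v
  to onAll k unbalanced = onAll (cycle k) (cycle-isCycle k) (trans (isBias k) unbalanced)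
  from : BalancingVertexOf β v → BalancingVertex twoC3 Γ v
  from onAll C cycC unbalanced =
    let k , C≡k = cycle-surjective C cycC
    in subst (λ C → Touches twoC3 C v) (sym C≡k)
             (onAll k (trans (sym (isBias k)) (subst (λ C → balanced Γ C ≡ false) C≡k unbalanced)))

biasedGraph : (β : Bias) → ¬ ThetaViolation β → BiasedGraph twoC3
biasedGraph β noViolation = record
  { balanced = balancedBy β
  ; balanced⇒cycle = balancedBy⇒cycle β
  ; thetaProperty = noTwoBalanced
  }
  where
  noTwoBalanced : ∀ Θ → Theta twoC3 Θ → ¬ ExactlyTwoBalanced twoC3 (balancedBy β) Θ
  noTwoBalanced Θ θ twoBalanced =
    let w , t , Θ≡ = theta⇒thetaEdges Θ θ
    in noViolation (w , t , Equivalence.to (exactlyTwoBalanced⇔ β (balancedBy β) (balancedBy-isBias β) w t)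
                                           (subst (ExactlyTwoBalanced twoC3 (balancedBy β)) Θ≡ twoBalanced))

biasOf : BiasedGraph twoC3 → Bias
biasOf Γ = tabulate (balanced Γ ∘ cycle)

biasOf-isBias : ∀ Γ → IsBiasOf (biasOf Γ) (balanced Γ)
biasOf-isBias Γ k = sym (Vec.lookup∘tabulate (balanced Γ ∘ cycle) k)

flipIf : Bool → Fin 2 → Fin 2
flipIf b i = if b then opposite i else i

flipIf-involutive : ∀ b i → flipIf b (flipIf b i) ≡ i
flipIf-involutive false i = refl
flipIf-involutive true i = opposite-involutive i

edgeMap : (Fin 3 → Fin 3) → (Fin 3 → Bool) → Fin 6 → Fin 6
edgeMap σ f e = edge (σ (oppositeVertex e)) (flipIf (f (oppositeVertex e)) (parallelIndex e))

edgeMap-cancel : ∀ {π ρ : Fin 3 → Fin 3} {g f : Fin 3 → Bool} → (∀ w → π (ρ w) ≡ w) → (∀ w → g (ρ w) ≡ f w) →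
                 ∀ e → edgeMap π g (edgeMap ρ f e) ≡ e
edgeMap-cancel {π} {ρ} {g} {f} πρ gρ e = begin
  edge (π (oppositeVertex e′)) (flipIf (g (oppositeVertex e′)) (parallelIndex e′))
    ≡⟨ cong₂ (λ v i → edge (π v) (flipIf (g v) i)) (oppositeVertex-edge (ρ w) j) (parallelIndex-edge (ρ w) j) ⟩
  edge (π (ρ w)) (flipIf (g (ρ w)) j)
    ≡⟨ cong₂ (λ v b → edge v (flipIf b j)) (πρ w) (gρ w) ⟩
  edge w (flipIf (f w) (flipIf (f w) (parallelIndex e)))
    ≡⟨ cong (edge w) (flipIf-involutive (f w) (parallelIndex e)) ⟩
  edge w (parallelIndex e)
    ≡⟨ edge-η e ⟩
  e ∎
  where
  open ≡-Reasoning
  w = oppositeVertex e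
  j = flipIf (f w) (parallelIndex e)
  e′ = edge (ρ w) j

edgePermutation : Permutation′ 3 → (Fin 3 → Bool) → Permutation′ 6
edgePermutation σ f = permutation (edgeMap (σ ⟨$⟩ʳ_) f) (edgeMap (σ ⟨$⟩ˡ_) (f ∘ (σ ⟨$⟩ˡ_)))
  (edgeMap-cancel {σ ⟨$⟩ʳ_} {σ ⟨$⟩ˡ_} {f} {f ∘ (σ ⟨$⟩ˡ_)} (λ _ → inverseʳ σ) (λ _ → refl))
  (edgeMap-cancel {σ ⟨$⟩ˡ_} {σ ⟨$⟩ʳ_} {f ∘ (σ ⟨$⟩ˡ_)} {f} (λ _ → inverseˡ σ) (λ _ → cong f (inverseˡ σ)))

Respects : Permutation′ 3 → Permutation′ 6 → Set
Respects σ τ = ∀ e →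
  (end₁ twoC3 (τ ⟨$⟩ʳ e) ≡ σ ⟨$⟩ʳ end₁ twoC3 e × end₂ twoC3 (τ ⟨$⟩ʳ e) ≡ σ ⟨$⟩ʳ end₂ twoC3 e)
  ⊎ (end₁ twoC3 (τ ⟨$⟩ʳ e) ≡ σ ⟨$⟩ʳ end₂ twoC3 e × end₂ twoC3 (τ ⟨$⟩ʳ e) ≡ σ ⟨$⟩ʳ end₁ twoC3 e)

⟨$⟩ʳ-injective : ∀ {n} (π : Permutation′ n) {x y} → π ⟨$⟩ʳ x ≡ π ⟨$⟩ʳ y → x ≡ y
⟨$⟩ʳ-injective π = Injection.injective (↔⇒↣ π)

flipsOf : Permutation′ 6 → Fin 3 → Bool
flipsOf τ w = does (parallelIndex (τ ⟨$⟩ʳ edge w 0F) ≟ 1F)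

opaque
  twinIndex : ∀ i x y → (x ≡ y → i ≡ 0F) → (i ≡ 0F → x ≡ y) → y ≡ flipIf (does (x ≟ 1F)) i
  twinIndex = from-yes (all? λ i → all? λ x → all? λ y → (x ≟ y →-dec i ≟ 0F) →-dec (i ≟ 0F →-dec x ≟ y) →-dec
    y ≟ flipIf (does (x ≟ 1F)) i)

module _ {σ : Permutation′ 3} {τ : Permutation′ 6} (respects : Respects σ τ) where

  oppositeVertex-respects : ∀ e → oppositeVertex (τ ⟨$⟩ʳ e) ≡ σ ⟨$⟩ʳ oppositeVertex e
  oppositeVertex-respects e =
    sym (avoidsEnds⇒oppositeVertex (τ ⟨$⟩ʳ e) _ (avoidsImages (Sum.map proj₁ proj₁ (respects e)))
                                                  (avoidsImages (Sum.swap (Sum.map proj₂ proj₂ (respects e)))))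
    where
    avoidsImages : ∀ {x} → x ≡ σ ⟨$⟩ʳ end₁ twoC3 e ⊎ x ≡ σ ⟨$⟩ʳ end₂ twoC3 e → σ ⟨$⟩ʳ oppositeVertex e ≢ x
    avoidsImages (inj₁ refl) eq = end₁≢oppositeVertex e (sym (⟨$⟩ʳ-injective σ eq))
    avoidsImages (inj₂ refl) eq = end₂≢oppositeVertex e (sym (⟨$⟩ʳ-injective σ eq))

  -- τ maps the two edges opposite w bijectively onto the two edges opposite σ w.
  parallelIndex-respects : ∀ e → parallelIndex (τ ⟨$⟩ʳ e) ≡ flipIf (flipsOf τ (oppositeVertex e)) (parallelIndex e)
  parallelIndex-respects e = twinIndex (parallelIndex e) _ _ sameIndex⇒first first⇒sameIndex
    where
    open ≡-Reasoning
    w = oppositeVertex e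
    e₀ = edge w 0F
    sameOpposite : oppositeVertex (τ ⟨$⟩ʳ e₀) ≡ oppositeVertex (τ ⟨$⟩ʳ e)
    sameOpposite = begin
      oppositeVertex (τ ⟨$⟩ʳ e₀) ≡⟨ oppositeVertex-respects e₀ ⟩
      σ ⟨$⟩ʳ oppositeVertex e₀   ≡⟨ cong (σ ⟨$⟩ʳ_) (oppositeVertex-edge w 0F) ⟩
      σ ⟨$⟩ʳ w                   ≡⟨ oppositeVertex-respects e ⟨
      oppositeVertex (τ ⟨$⟩ʳ e)  ∎
    first⇒sameIndex : parallelIndex e ≡ 0F → parallelIndex (τ ⟨$⟩ʳ e₀) ≡ parallelIndex (τ ⟨$⟩ʳ e)
    first⇒sameIndex first = cong (parallelIndex ∘ (τ ⟨$⟩ʳ_)) (trans (cong (edge w) (sym first)) (edge-η e))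
    sameIndex⇒first : parallelIndex (τ ⟨$⟩ʳ e₀) ≡ parallelIndex (τ ⟨$⟩ʳ e) → parallelIndex e ≡ 0F
    sameIndex⇒first sameIndex = trans (cong parallelIndex (sym e₀≡e)) (parallelIndex-edge w 0F)
      where
      e₀≡e : e₀ ≡ e
      e₀≡e = ⟨$⟩ʳ-injective τ (begin
        τ ⟨$⟩ʳ e₀                                                     ≡⟨ edge-η (τ ⟨$⟩ʳ e₀) ⟨
        edge (oppositeVertex (τ ⟨$⟩ʳ e₀)) (parallelIndex (τ ⟨$⟩ʳ e₀)) ≡⟨ cong₂ edge sameOpposite sameIndex ⟩
        edge (oppositeVertex (τ ⟨$⟩ʳ e)) (parallelIndex (τ ⟨$⟩ʳ e))   ≡⟨ edge-η (τ ⟨$⟩ʳ e) ⟩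
        τ ⟨$⟩ʳ e                                                      ∎)

  respects⇒edgeMap : ∀ e → τ ⟨$⟩ʳ e ≡ edgeMap (σ ⟨$⟩ʳ_) (flipsOf τ) e
  respects⇒edgeMap e =
    trans (sym (edge-η (τ ⟨$⟩ʳ e))) (cong₂ edge (oppositeVertex-respects e) (parallelIndex-respects e))

S₃ : Fin 6 → Permutation′ 3
S₃ 0F = id
S₃ 1F = transpose 0F 1F
S₃ 2F = transpose 0F 2F
S₃ 3F = transpose 1F 2F
S₃ 4F = transpose 0F 1F ∘ₚ transpose 1F 2F
S₃ 5F = transpose 1F 2F ∘ₚ transpose 0F 1F

opaque
  S₃-values : ∀ x y z → x ≢ y → x ≢ z → y ≢ z →
              ∃ λ s → S₃ s ⟨$⟩ʳ 0F ≡ x × S₃ s ⟨$⟩ʳ 1F ≡ y × S₃ s ⟨$⟩ʳ 2F ≡ z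
  S₃-values = from-yes (all? λ x → all? λ y → all? λ z → ¬? (x ≟ y) →-dec ¬? (x ≟ z) →-dec ¬? (y ≟ z) →-dec
    any? λ s → S₃ s ⟨$⟩ʳ 0F ≟ x ×-dec S₃ s ⟨$⟩ʳ 1F ≟ y ×-dec S₃ s ⟨$⟩ʳ 2F ≟ z)

S₃-complete : (σ : Permutation′ 3) → ∃ λ s → ∀ v → σ ⟨$⟩ʳ v ≡ S₃ s ⟨$⟩ʳ v
S₃-complete σ with S₃-values (σ ⟨$⟩ʳ 0F) (σ ⟨$⟩ʳ 1F) (σ ⟨$⟩ʳ 2F)
                     ((λ ()) ∘ ⟨$⟩ʳ-injective σ) ((λ ()) ∘ ⟨$⟩ʳ-injective σ) ((λ ()) ∘ ⟨$⟩ʳ-injective σ)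
... | s , σ0 , σ1 , σ2 = s , λ { 0F → sym σ0 ; 1F → sym σ1 ; 2F → sym σ2 }

edgeAut : Fin 6 → Subset 3 → Permutation′ 6
edgeAut s F = edgePermutation (S₃ s) (lookup F)

opaque
  edgeAut-respects : ∀ s F → Respects (S₃ s) (edgeAut s F)
  edgeAut-respects = from-yes (all? λ s → ∀-subset? λ F → all? λ e →
    let σ = S₃ s ; τ = edgeAut s F in
    (end₁ twoC3 (τ ⟨$⟩ʳ e) ≟ σ ⟨$⟩ʳ end₁ twoC3 e ×-dec end₂ twoC3 (τ ⟨$⟩ʳ e) ≟ σ ⟨$⟩ʳ end₂ twoC3 e)
    ⊎-dec (end₁ twoC3 (τ ⟨$⟩ʳ e) ≟ σ ⟨$⟩ʳ end₂ twoC3 e ×-dec end₂ twoC3 (τ ⟨$⟩ʳ e) ≟ σ ⟨$⟩ʳ end₁ twoC3 e))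

respects⇒edgeAut : ∀ {σ τ} → Respects σ τ → ∃ λ s → ∃ λ F → ∀ e → τ ⟨$⟩ʳ e ≡ edgeAut s F ⟨$⟩ʳ e
respects⇒edgeAut {σ} {τ} respects with S₃-complete σ
... | s , σ≗S₃s = s , tabulate (flipsOf τ) , λ e →
  trans (respects⇒edgeMap {σ} {τ} respects e)
        (cong₂ (λ v b → edge v (flipIf b (parallelIndex e))) (σ≗S₃s (oppositeVertex e))
               (sym (Vec.lookup∘tabulate (flipsOf τ) (oppositeVertex e))))

image-cong : ∀ {π ρ : Permutation′ 6} → (∀ e → π ⟨$⟩ʳ e ≡ ρ ⟨$⟩ʳ e) → ∀ C → image twoC3 π C ≡ image twoC3 ρ C
image-cong {π} {ρ} π≗ρ C = Vec.tabulate-cong λ e → cong (lookup C) (begin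
  π ⟨$⟩ˡ e                  ≡⟨ cong (π ⟨$⟩ˡ_) (inverseʳ ρ) ⟨
  π ⟨$⟩ˡ (ρ ⟨$⟩ʳ (ρ ⟨$⟩ˡ e)) ≡⟨ cong (π ⟨$⟩ˡ_) (π≗ρ _) ⟨
  π ⟨$⟩ˡ (π ⟨$⟩ʳ (ρ ⟨$⟩ˡ e)) ≡⟨ inverseˡ π ⟩
  ρ ⟨$⟩ˡ e                  ∎)
  where open ≡-Reasoning

Carries : Permutation′ 6 → Bias → Bias → Set
Carries τ β β′ = ∀ k → balancedBy β′ (image twoC3 τ (cycle k)) ≡ lookup β k

carries? : ∀ τ β β′ → Dec (Carries τ β β′)
carries? τ β β′ = all? λ k → balancedBy β′ (image twoC3 τ (cycle k)) Bool.≟ lookup β k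

triangleAt : Fin 2 → Fin 2 → Fin 2 → Fin 11
triangleAt a b c = triangleIx (a ∷ b ∷ c ∷ [])

representative : Fin 6 → Bias
representative 0F = ⊥
representative 1F = ⁅ triangleAt 0F 0F 0F ⁆
representative 2F = ⁅ triangleAt 1F 0F 0F ⁆ ∪ ⁅ triangleAt 0F 1F 0F ⁆
representative 3F = ⁅ triangleAt 1F 0F 0F ⁆ ∪ ⁅ triangleAt 0F 1F 0F ⁆ ∪ ⁅ triangleAt 0F 0F 1F ⁆
representative 4F = ⁅ triangleAt 1F 0F 0F ⁆ ∪ ⁅ triangleAt 0F 1F 1F ⁆
representative 5F = ⁅ triangleAt 0F 0F 0F ⁆ ∪ ⁅ triangleAt 0F 1F 1F ⁆ ∪ ⁅ triangleAt 1F 0F 1F ⁆ ∪ ⁅ triangleAt 1F 1F 0F ⁆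

opaque
  representative-noThetaViolation : ∀ i → ¬ ThetaViolation (representative i)
  representative-noThetaViolation = from-yes (all? λ i → ¬? (thetaViolation? (representative i)))

  representative-noBalancingVertex : ∀ i v → ¬ BalancingVertexOf (representative i) v
  representative-noBalancingVertex = from-yes (all? λ i → all? λ v → ¬? (balancingVertexOf? (representative i) v))

  representatives-inequivalent : ∀ s F i j → Carries (edgeAut s F) (representative i) (representative j) → i ≡ j
  representatives-inequivalent = from-yes (all? λ s → ∀-subset? λ F → all? λ i → all? λ j →
    carries? (edgeAut s F) (representative i) (representative j) →-dec i ≟ j)

  bias-trichotomy : ∀ β → ThetaViolation β ⊎ (∃ λ v → BalancingVertexOf β v)
                          ⊎ (∃ λ i → ∃ λ s → ∃ λ F → Carries (edgeAut s F) β (representative i))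
  bias-trichotomy = from-yes (∀-subset? λ β → thetaViolation? β ⊎-dec (any? λ v → balancingVertexOf? β v)
    ⊎-dec any? λ i → any? λ s → anySubset? λ F → carries? (edgeAut s F) β (representative i))

Ω : Fin 6 → BiasedGraph twoC3
Ω i = biasedGraph (representative i) (representative-noThetaViolation i)

iso⇒carries : ∀ i j → Iso twoC3 (Ω i) (Ω j) → ∃ λ s → ∃ λ F → Carries (edgeAut s F) (representative i) (representative j)
iso⇒carries i j iso =
  let s , F , τ≗ = respects⇒edgeAut {Iso.σ iso} {Iso.τ iso} (Iso.incidence iso)
  in s , F , λ k → begin
    balancedBy (representative j) (image twoC3 (edgeAut s F) (cycle k))
      ≡⟨ cong (balancedBy (representative j)) (image-cong {Iso.τ iso} {edgeAut s F} τ≗ (cycle k)) ⟨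
    balancedBy (representative j) (image twoC3 (Iso.τ iso) (cycle k))
      ≡⟨ Iso.preservesBalance iso (cycle k) (cycle-isCycle k) ⟩
    balancedBy (representative i) (cycle k)
      ≡⟨ balancedBy-isBias (representative i) k ⟩
    lookup (representative i) k ∎
  where open ≡-Reasoning

carries⇒iso : ∀ Γ β → IsBiasOf β (balanced Γ) → ∀ i s F → Carries (edgeAut s F) β (representative i) →
              Iso twoC3 Γ (Ω i)
carries⇒iso Γ β isBias i s F carries = record
  { σ = S₃ s
  ; τ = edgeAut s F
  ; incidence = edgeAut-respects s F
  ; preservesBalance = preservesBalance
  }
  where
  preservesBalance : ∀ C → Cycle twoC3 C → balancedBy (representative i) (image twoC3 (edgeAut s F) C) ≡ balanced Γ C
  preservesBalance C cycC =
    let k , C≡k = cycle-surjective C cycC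
    in subst (λ C → balancedBy (representative i) (image twoC3 (edgeAut s F) C) ≡ balanced Γ C) (sym C≡k)
             (trans (carries k) (sym (isBias k)))

mainTheorem9 : Σ (Fin 6 → BiasedGraph twoC3) λ Ω →
      (∀ i → NoBalancingVertex twoC3 (Ω i))
      × (∀ i j → Iso twoC3 (Ω i) (Ω j) → i ≡ j)
      × (∀ Γ → NoBalancingVertex twoC3 Γ → ∃ λ i → Iso twoC3 Γ (Ω i))
mainTheorem9 = Ω , noBalancingVertex , inequivalent , complete
  where
  noBalancingVertex : ∀ i → NoBalancingVertex twoC3 (Ω i)
  noBalancingVertex i v = representative-noBalancingVertex i v
    ∘ Equivalence.to (balancingVertex⇔ (Ω i) (representative i) (balancedBy-isBias (representative i)) v)

  inequivalent : ∀ i j → Iso twoC3 (Ω i) (Ω j) → i ≡ j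
  inequivalent i j iso = let s , F , carries = iso⇒carries i j iso in representatives-inequivalent s F i j carries

  complete : ∀ Γ → NoBalancingVertex twoC3 Γ → ∃ λ i → Iso twoC3 Γ (Ω i)
  complete Γ noBalancingVertex with bias-trichotomy (biasOf Γ)
  ... | inj₁ (w , t , twoBalanced) = ⊥-elim (thetaProperty Γ (thetaEdges w t) (thetaEdges-isTheta w t)
          (Equivalence.from (exactlyTwoBalanced⇔ (biasOf Γ) (balanced Γ) (biasOf-isBias Γ) w t) twoBalanced))
  ... | inj₂ (inj₁ (v , balancing)) = ⊥-elim (noBalancingVertex v
          (Equivalence.from (balancingVertex⇔ Γ (biasOf Γ) (biasOf-isBias Γ) v) balancing))
  ... | inj₂ (inj₂ (i , s , F , carries)) = i , carries⇒iso Γ (biasOf Γ) (biasOf-isBias Γ) i s F carries
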